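{- Let $r \ge 3$ be an integer. If $G$ is a connected graph of order $n$ with maximum degree $\Delta(G) \le r$, then \[ \gamma_c(G) \ge \frac{n-2}{r-1}, \] with equality if and only if $G$ has a spanning tree that is a $(1,r)$-tree.
   Context: All graphs are finite, simple and undirected. A connected dominating set of $G$ is a set $S \subseteq V(G)$ such that every vertex not in $S$ has a neighbor in $S$ and $G[S]$ is connected; $\gamma_c(G)$ is the minimum cardinality of a connected dominating set of $G$. For $r \ge 3$, a $(1,r)$-tree is a tree in which every vertex has degree $1$ or $r$. -}

module Defs where

open import Data.Nat using (ℕ; _≤_; _+_)
open import Data.Bool using (Bool; true; false; T; if_then_else_)
open import Data.Fin using (Fin)
open import Data.Fin.Subset using (Subset; _∈_; _∉_; ∣_∣)
open import Data.List using (List; []; _∷_; _++_; length; map; allFin)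
open import Data.Nat.ListAction using (sum)
open import Data.List.Relation.Unary.Unique.Propositional using (Unique)
open import Data.List.Relation.Unary.Linked using (Linked)
open import Data.Product using (Σ; ∃; ∃-syntax; _×_)
open import Data.Sum using (_⊎_)
open import Data.Unit using (⊤)
open import Relation.Nullary using (¬_)
open import Relation.Binary.PropositionalEquality using (_≡_)

record Graph (n : ℕ) : Set where
  field
    adj    : Fin n → Fin n → Bool
    sym    : ∀ u v → adj u v ≡ adj v u
    irrefl : ∀ v → adj v v ≡ false

open Graph public

Edge : ∀ {n} → Graph n → Fin n → Fin n → Set
Edge G u v = T (adj G u v)

degree : ∀ {n} → Graph n → Fin n → ℕ
degree {n} G v = sum (map (λ u → if adj G v u then 1 else 0) (allFin n))

MaxDegreeAtMost : ∀ {n} → Graph n → ℕ → Set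
MaxDegreeAtMost G r = ∀ v → degree G v ≤ r

-- walks in G all of whose vertices satisfy P (i.e. walks in G[P])
data Walk {n} (G : Graph n) (P : Fin n → Set) : Fin n → Fin n → Set where
  here : ∀ {u} → P u → Walk G P u u
  step : ∀ {u w v} → P u → Edge G u w → Walk G P w v → Walk G P u v

ConnectedOn : ∀ {n} → Graph n → (Fin n → Set) → Set
ConnectedOn G P = (∃[ v ] P v) × (∀ u v → P u → P v → Walk G P u v)

Connected : ∀ {n} → Graph n → Set
Connected G = ConnectedOn G (λ _ → ⊤)

IsCDS : ∀ {n} → Graph n → Subset n → Set
IsCDS G S = (∀ v → v ∉ S → ∃[ u ] (u ∈ S × Edge G v u))
          × ConnectedOn G (λ v → v ∈ S)

IsMinimumCDS : ∀ {n} → Graph n → Subset n → Set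
IsMinimumCDS G S = IsCDS G S × (∀ S′ → IsCDS G S′ → ∣ S ∣ ≤ ∣ S′ ∣)

HasCycle : ∀ {n} → Graph n → Set
HasCycle {n} G = Σ (Fin n) λ v → Σ (List (Fin n)) λ vs →
  Unique (v ∷ vs) × (2 ≤ length vs) × Linked (Edge G) (v ∷ (vs ++ (v ∷ [])))

IsTree : ∀ {n} → Graph n → Set
IsTree G = Connected G × ¬ HasCycle G

Is1rTree : ∀ {n} → ℕ → Graph n → Set
Is1rTree r T′ = IsTree T′ × (∀ v → degree T′ v ≡ 1 ⊎ degree T′ v ≡ r)

SpanningSubgraph : ∀ {n} → Graph n → Graph n → Set
SpanningSubgraph T′ G = ∀ u v → Edge T′ u v → Edge G u v

HasSpanning1rTree : ∀ {n} → ℕ → Graph n → Set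
HasSpanning1rTree {n} r G = Σ (Graph n) λ T′ → SpanningSubgraph T′ G × Is1rTree r T′

module Submission where

-- Let S be a connected dominating set.  Growing a breadth-first tree from a vertex of S,
-- and letting every vertex not in S hang off one of its neighbours in S, gives a spanning
-- tree T of G all of whose non-leaves lie in S.  Counting vertices by their parents,
--   n − 1 = Σₓ children(x) ≤ r + (r − 1)(|S| − 1),
-- since the root has at most r children, every other vertex of S at most r − 1 and no vertex
-- outside S has any.  Equality forces every vertex of S to have degree r in T and every other
-- vertex degree 1: T is then a spanning (1,r)-tree.  Conversely, for n ≥ 3 the internal
-- vertices I of a spanning (1,r)-tree K form a connected dominating set, and since the tree
-- built inside K uses every edge of K the count is exact: n = (r − 1)|I| + 2.

open import Defs hiding (sym)
open import Data.Bool using (true; false; T; if_then_else_)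
open import Data.Empty using (⊥; ⊥-elim)
open import Data.Fin using (Fin; zero; suc; _≟_)
open import Data.Fin.Properties using (any?)
open import Data.Fin.Subset using (Subset; _∈_; _∉_; ∣_∣; inside; outside)
open import Data.Fin.Subset.Properties using (_∈?_)
open import Data.List using (List; []; _∷_; [_]; _++_; length; map; tabulate)
open import Data.List.Membership.Propositional using () renaming (_∈_ to _∈ₗ_)
import Data.List.Membership.DecPropositional as DecMembership
open import Data.List.Relation.Unary.All using (All; []; _∷_)
import Data.List.Relation.Unary.All as All
open import Data.List.Relation.Unary.All.Properties using (¬Any⇒All¬)
open import Data.List.Relation.Unary.Any using (here; there)
open import Data.List.Relation.Unary.Linked using (Linked; []; [-]; _∷_)
import Data.List.Relation.Unary.Linked as Linked
open import Data.List.Relation.Unary.Unique.Propositional using (Unique; []; _∷_)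
import Data.List.Relation.Unary.Unique.Propositional.Properties as Unique
open import Data.Nat using (ℕ; zero; suc; _≤_; _<_; _+_; _*_; _∸_; z≤n; s≤s)
import Data.Nat as ℕ
open import Data.Nat.Properties hiding (_≟_)
open import Algebra.Properties.Semiring.Sum +-*-semiring
  using (sum-syntax; sum-cong-≗; ∑-distrib-+; ∑-comm; *-distribˡ-sum; sum-replicate-zero)
import Data.Nat.ListAction as List
open import Data.Product using (Σ-syntax; ∃-syntax; _×_; _,_; proj₁; proj₂)
open import Data.Sum using (_⊎_; inj₁; inj₂; [_,_]′)
import Data.Sum as Sum
open import Data.Unit using (⊤; tt)
open import Data.Vec using ([]; _∷_)
import Data.Vec as Vec
open import Data.Vec.Properties using (lookup∘tabulate; lookup⇒[]=; []=⇒lookup)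
open import Function using (_∘_; id; flip; _⇔_; mk⇔)
open import Relation.Binary using (Transitive)
open import Relation.Binary.PropositionalEquality hiding ([_])
open import Relation.Nullary using (¬_; Dec; yes; no; does; contradiction)
open import Relation.Nullary.Decidable using (T?; ¬?; _×-dec_; _⊎-dec_; dec-true; dec-false; does-⇔)
open import Relation.Unary using (Decidable)

-- Iverson brackets and finite sums

𝟙 : {P : Set} → Dec P → ℕ
𝟙 p? = if does p? then 1 else 0

𝟙-yes : {P : Set} (p? : Dec P) → P → 𝟙 p? ≡ 1
𝟙-yes p? p = cong (if_then 1 else 0) (dec-true p? p)

𝟙-no : {P : Set} (p? : Dec P) → ¬ P → 𝟙 p? ≡ 0
𝟙-no p? ¬p = cong (if_then 1 else 0) (dec-false p? ¬p)

𝟙-¬+𝟙 : {P : Set} (p? : Dec P) → 𝟙 (¬? p?) + 𝟙 p? ≡ 1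
𝟙-¬+𝟙 (yes _) = refl
𝟙-¬+𝟙 (no _)  = refl

module _ {P Q : Set} where

  𝟙-cong : P ⇔ Q → (p? : Dec P) (q? : Dec Q) → 𝟙 p? ≡ 𝟙 q?
  𝟙-cong P⇔Q p? q? = cong (if_then 1 else 0) (does-⇔ P⇔Q p? q?)

  𝟙-mono : (P → Q) → (p? : Dec P) (q? : Dec Q) → 𝟙 p? ≤ 𝟙 q?
  𝟙-mono P→Q (yes p) q? = ≤-reflexive (sym (𝟙-yes q? (P→Q p)))
  𝟙-mono P→Q (no _)  q? = z≤n

  𝟙-⊎ : (P → Q → ⊥) → (p? : Dec P) (q? : Dec Q) → 𝟙 (p? ⊎-dec q?) ≡ 𝟙 p? + 𝟙 q?
  𝟙-⊎ disjoint (yes p) (yes q) = contradiction q (disjoint p)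
  𝟙-⊎ disjoint (yes _) (no _)  = refl
  𝟙-⊎ disjoint (no _)  (yes _) = refl
  𝟙-⊎ disjoint (no _)  (no _)  = refl

from-does : {P : Set} (p? : Dec P) → T (does p?) → P
from-does (yes p) _ = p

to-does : {P : Set} (p? : Dec P) → P → T (does p?)
to-does (yes _) _ = tt
to-does (no ¬p) p = ¬p p

∑-mono-≤ : ∀ {n} {f g : Fin n → ℕ} → (∀ i → f i ≤ g i) → ∑[ i < n ] f i ≤ ∑[ i < n ] g i
∑-mono-≤ {zero}  f≤g = z≤n
∑-mono-≤ {suc n} f≤g = +-mono-≤ (f≤g zero) (∑-mono-≤ (f≤g ∘ suc))

∑-mono-≡⇒≗ : ∀ {n} {f g : Fin n → ℕ} → (∀ i → f i ≤ g i) →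
             ∑[ i < n ] f i ≡ ∑[ i < n ] g i → ∀ i → f i ≡ g i
∑-mono-≡⇒≗ {suc n} {f} {g} f≤g ∑f≡∑g = λ where
    zero    → f₀≡g₀
    (suc i) → ∑-mono-≡⇒≗ (f≤g ∘ suc) (+-cancelˡ-≡ (f zero) _ _ tails) i
  where
  f₀≡g₀ : f zero ≡ g zero
  f₀≡g₀ = ≤-antisym (f≤g zero) (+-cancelʳ-≤ _ (g zero) (f zero) (begin
    g zero + ∑[ i < n ] f (suc i) ≤⟨ +-monoʳ-≤ (g zero) (∑-mono-≤ (f≤g ∘ suc)) ⟩
    g zero + ∑[ i < n ] g (suc i) ≡⟨ ∑f≡∑g ⟨
    f zero + ∑[ i < n ] f (suc i) ∎))
    where open ≤-Reasoning
  tails : f zero + ∑[ i < n ] f (suc i) ≡ f zero + ∑[ i < n ] g (suc i)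
  tails = trans ∑f≡∑g (cong (_+ _) (sym f₀≡g₀))

∑-𝟙-≟ : ∀ {n} (c : Fin n) → ∑[ i < n ] 𝟙 (i ≟ c) ≡ 1
∑-𝟙-≟ {suc n} zero    = cong suc (sum-replicate-zero n)
∑-𝟙-≟ {suc n} (suc c) = ∑-𝟙-≟ c

∑-𝟙-singleton : ∀ {n} {P : Fin n → Set} (P? : ∀ i → Dec (P i)) c →
                (∀ i → P i ⇔ i ≡ c) → ∑[ i < n ] 𝟙 (P? i) ≡ 1
∑-𝟙-singleton P? c P⇔≡c = trans (sum-cong-≗ (λ i → 𝟙-cong (P⇔≡c i) (P? i) (i ≟ c))) (∑-𝟙-≟ c)

∑-𝟙-empty : ∀ {n} {P : Fin n → Set} (P? : ∀ i → Dec (P i)) →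
            (∀ i → ¬ P i) → ∑[ i < n ] 𝟙 (P? i) ≡ 0
∑-𝟙-empty {n} P? ¬P = trans (sum-cong-≗ (λ i → 𝟙-no (P? i) (¬P i))) (sum-replicate-zero n)

∑-1 : ∀ n → ∑[ i < n ] 1 ≡ n
∑-1 zero    = refl
∑-1 (suc n) = cong suc (∑-1 n)

∣S∣≡∑ : ∀ {n} (S : Subset n) → ∣ S ∣ ≡ ∑[ x < n ] 𝟙 (x ∈? S)
∣S∣≡∑ []            = refl
∣S∣≡∑ (inside  ∷ S) = cong suc (∣S∣≡∑ S)
∣S∣≡∑ (outside ∷ S) = ∣S∣≡∑ S

sum-map-tabulate : ∀ {A : Set} n (g : Fin n → A) (f : A → ℕ) →
                   List.sum (map f (tabulate g)) ≡ ∑[ i < n ] f (g i)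
sum-map-tabulate zero    g f = refl
sum-map-tabulate (suc n) g f = cong (f (g zero) +_) (sum-map-tabulate n (g ∘ suc) f)

subset : ∀ {n} {P : Fin n → Set} → (∀ x → Dec (P x)) → Subset n
subset P? = Vec.tabulate (does ∘ P?)

module _ {n} {P : Fin n → Set} (P? : ∀ x → Dec (P x)) where

  ∈-subset⁺ : ∀ {x} → P x → x ∈ subset P?
  ∈-subset⁺ {x} p = lookup⇒[]= x _ (trans (lookup∘tabulate _ x) (dec-true (P? x) p))

  ∈-subset⁻ : ∀ {x} → x ∈ subset P? → P x
  ∈-subset⁻ {x} x∈ = from-does (P? x) (subst T (trans (sym ([]=⇒lookup x∈)) (lookup∘tabulate _ x)) tt)

degree≡∑ : ∀ {n} (G : Graph n) v → degree G v ≡ ∑[ u < n ] 𝟙 (T? (adj G v u))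
degree≡∑ {n} G v = sum-map-tabulate n id _

degree-mono : ∀ {n} {G H : Graph n} v → (∀ {u} → Edge G v u → Edge H v u) → degree G v ≤ degree H v
degree-mono {n} {G} {H} v G⊆H = begin
  degree G v                      ≡⟨ degree≡∑ G v ⟩
  ∑[ u < n ] 𝟙 (T? (adj G v u))  ≤⟨ ∑-mono-≤ (λ u → 𝟙-mono G⊆H (T? (adj G v u)) (T? (adj H v u))) ⟩
  ∑[ u < n ] 𝟙 (T? (adj H v u))  ≡⟨ degree≡∑ H v ⟨
  degree H v                      ∎
  where open ≤-Reasoning

degree-cong : ∀ {n} {G H : Graph n} v → (∀ {u} → Edge G v u ⇔ Edge H v u) → degree G v ≡ degree H v
degree-cong {n} {G} {H} v G⇔H = begin
  degree G v                      ≡⟨ degree≡∑ G v ⟩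
  ∑[ u < n ] 𝟙 (T? (adj G v u))  ≡⟨ sum-cong-≗ (λ u → 𝟙-cong G⇔H (T? (adj G v u)) (T? (adj H v u))) ⟩
  ∑[ u < n ] 𝟙 (T? (adj H v u))  ≡⟨ degree≡∑ H v ⟨
  degree H v                      ∎
  where open ≡-Reasoning

two-neighbours⇒2≤degree : ∀ {n} (G : Graph n) {v a b} → a ≢ b → Edge G v a → Edge G v b → 2 ≤ degree G v
two-neighbours⇒2≤degree {n} G {v} {a} {b} a≢b va vb = begin
  2                                            ≡⟨ cong₂ _+_ (∑-𝟙-≟ a) (∑-𝟙-≟ b) ⟨
  ∑[ u < n ] 𝟙 (u ≟ a) + ∑[ u < n ] 𝟙 (u ≟ b)  ≡⟨ ∑-distrib-+ (λ u → 𝟙 (u ≟ a)) (λ u → 𝟙 (u ≟ b)) ⟨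
  ∑[ u < n ] (𝟙 (u ≟ a) + 𝟙 (u ≟ b))           ≡⟨ sum-cong-≗ (λ u → 𝟙-⊎ (λ { refl refl → a≢b refl }) (u ≟ a) (u ≟ b)) ⟨
  ∑[ u < n ] 𝟙 ((u ≟ a) ⊎-dec (u ≟ b))          ≤⟨ ∑-mono-≤ (λ u → 𝟙-mono (λ { (inj₁ refl) → va ; (inj₂ refl) → vb })
                                                     ((u ≟ a) ⊎-dec (u ≟ b)) (T? (adj G v u))) ⟩
  ∑[ u < n ] 𝟙 (T? (adj G v u))                ≡⟨ degree≡∑ G v ⟨
  degree G v                                   ∎
  where open ≤-Reasoning

leaf-neighbour-unique : ∀ {n} (G : Graph n) {v a b} → degree G v ≡ 1 → Edge G v a → Edge G v b → a ≡ b
leaf-neighbour-unique G {a = a} {b} leaf va vb with a ≟ b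
... | yes a≡b = a≡b
... | no  a≢b = contradiction (subst (2 ≤_) leaf (two-neighbours⇒2≤degree G a≢b va vb)) λ { (s≤s ()) }

-- Walks

edge-sym : ∀ {n} (G : Graph n) {u v} → Edge G u v → Edge G v u
edge-sym G {u} {v} = subst T (Graph.sym G u v)

walk-map : ∀ {n} {G H : Graph n} {P Q : Fin n → Set} → (∀ {x} → P x → Q x) →
           (∀ {x y} → Edge G x y → Edge H x y) → ∀ {u v} → Walk G P u v → Walk H Q u v
walk-map f g (here p)     = here (f p)
walk-map f g (step p e ω) = step (f p) (g e) (walk-map f g ω)

module _ {n} {G : Graph n} {P : Fin n → Set} where

  walk-start : ∀ {u v} → Walk G P u v → P u
  walk-start (here p)     = p
  walk-start (step p _ _) = p

  _++ʷ_ : ∀ {u v w} → Walk G P u v → Walk G P v w → Walk G P u w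
  here _     ++ʷ ω′ = ω′
  step p e ω ++ʷ ω′ = step p e (ω ++ʷ ω′)

  walk-reverse : ∀ {u v} → Walk G P u v → Walk G P v u
  walk-reverse (here p)     = here p
  walk-reverse (step p e ω) = walk-reverse ω ++ʷ step (walk-start ω) (edge-sym G e) (here p)

  vertices : ∀ {u v} → Walk G P u v → List (Fin n)
  vertices (here {u} _)     = [ u ]
  vertices (step {u} _ _ ω) = u ∷ vertices ω

  1≤length-vertices : ∀ {u v} (ω : Walk G P u v) → 1 ≤ length (vertices ω)
  1≤length-vertices (here _)     = s≤s z≤n
  1≤length-vertices (step _ _ _) = s≤s z≤n

  vertices-++-linked : ∀ {R : Fin n → Fin n → Set} → (∀ {x y} → Edge G x y → R x y) →
                       ∀ {u v w} (ω : Walk G P u v) → R v w → Linked R (vertices ω ++ [ w ])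
  vertices-++-linked f (here _)                   r = r ∷ [-]
  vertices-++-linked f (step _ e (here _))        r = f e ∷ r ∷ [-]
  vertices-++-linked f (step _ e ω@(step _ _ _)) r = f e ∷ vertices-++-linked f ω r

  SimpleWalk : Fin n → Fin n → Set
  SimpleWalk u v = Σ[ ω ∈ Walk G P u v ] Unique (vertices ω)

  suffix-from : ∀ {u v x} (ω : Walk G P u v) → Unique (vertices ω) → x ∈ₗ vertices ω → SimpleWalk x v
  suffix-from ω@(here _)     ! (here refl)  = ω , !
  suffix-from ω@(step _ _ _) ! (here refl)  = ω , !
  suffix-from (step _ _ ω) (_ ∷ !) (there x∈) = suffix-from ω ! x∈

  loop-erase : ∀ {u v} → Walk G P u v → SimpleWalk u v
  loop-erase (here p) = here p , [] ∷ []
  loop-erase (step {u} p e ω) with loop-erase ω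
  ... | ω′ , ! with DecMembership._∈?_ _≟_ u (vertices ω′)
  ...   | yes u∈ = suffix-from ω′ ! u∈
  ...   | no  u∉ = step p e ω′ , ¬Any⇒All¬ _ u∉ ∷ !

neighbour : ∀ {n} {G : Graph n} {v w} → Connected G → v ≢ w → ∃[ u ] Edge G v u
neighbour {v = v} {w} (_ , walk) v≢w with walk v w tt tt
... | here _     = contradiction refl v≢w
... | step _ e _ = _ , e

cds-spanning : ∀ {n} {K G : Graph n} {S} → SpanningSubgraph K G → IsCDS K S → IsCDS G S
cds-spanning K⊆G (dominating , nonempty , connected) =
  (λ v v∉S → let u , u∈S , vu = dominating v v∉S in u , u∈S , K⊆G _ _ vu) ,
  nonempty , λ u v u∈S v∈S → walk-map id (K⊆G _ _) (connected u v u∈S v∈S)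

Linked-ends : ∀ {A : Set} {R : A → A → Set} → Transitive R →
              ∀ {x z} L → Linked R (x ∷ L ++ [ z ]) → R x z
Linked-ends trans []      (r ∷ [-]) = r
Linked-ends trans (_ ∷ L) (r ∷ rs)  = trans r (Linked-ends trans L rs)

NonBacktracking : ∀ {A : Set} → List A → Set
NonBacktracking (x ∷ y ∷ z ∷ L) = x ≢ z × NonBacktracking (y ∷ z ∷ L)
NonBacktracking _               = ⊤

Unique⇒NonBacktracking : ∀ {A : Set} {L : List A} → Unique L → NonBacktracking L
Unique⇒NonBacktracking []                               = tt
Unique⇒NonBacktracking (_ ∷ [])                         = tt
Unique⇒NonBacktracking (_ ∷ _ ∷ [])                     = tt
Unique⇒NonBacktracking ((_ ∷ x≢z ∷ _) ∷ !@(_ ∷ _ ∷ _)) = x≢z , Unique⇒NonBacktracking !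

Unique-++-[] : ∀ {A : Set} {L : List A} {z} → Unique L → All (z ≢_) L → Unique (L ++ [ z ])
Unique-++-[] ! z∉L = Unique.++⁺ ! ([] ∷ []) λ where (x∈L , here refl) → All.lookup z∉L x∈L refl

-- Rooted spanning trees

-- A spanning tree of H given by parent pointers into S, so every vertex outside S is a
-- leaf; rank makes following parents terminate at the root (parent root is a junk value).
record RootedTree {n} (H : Graph n) (S : Subset n) : Set where
  field
    root        : Fin n
    root∈S      : root ∈ S
    parent      : Fin n → Fin n
    rank        : Fin n → ℕ
    parent∈S    : ∀ v → v ≢ root → parent v ∈ S
    parent-edge : ∀ v → v ≢ root → Edge H v (parent v)
    rank-parent : ∀ v → v ≢ root → rank (parent v) < rank v

module RootedTreeProperties {n} {H : Graph n} {S : Subset n} (𝒯 : RootedTree H S) where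
  open RootedTree 𝒯

  Up : Fin n → Fin n → Set
  Up x y = x ≢ root × parent x ≡ y

  TreeEdge : Fin n → Fin n → Set
  TreeEdge x y = Up x y ⊎ Up y x

  up? : ∀ x y → Dec (Up x y)
  up? x y = ¬? (x ≟ root) ×-dec (parent x ≟ y)

  tree-edge? : ∀ x y → Dec (TreeEdge x y)
  tree-edge? x y = up? x y ⊎-dec up? y x

  up-rank : ∀ {x y} → Up x y → rank y < rank x
  up-rank (x≢root , refl) = rank-parent _ x≢root

  up-irreflexive : ∀ {x} → ¬ Up x x
  up-irreflexive u = <-irrefl refl (up-rank u)

  up-asymmetric : ∀ {x y} → Up x y → ¬ Up y x
  up-asymmetric u u′ = <-asym (up-rank u) (up-rank u′)

  up-edge : ∀ {x y} → Up x y → Edge H x y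
  up-edge (x≢root , refl) = parent-edge _ x≢root

  tree-edge-edge : ∀ {x y} → TreeEdge x y → Edge H x y
  tree-edge-edge (inj₁ u) = up-edge u
  tree-edge-edge (inj₂ u) = edge-sym H (up-edge u)

  children : Fin n → ℕ
  children x = ∑[ y < n ] 𝟙 (up? y x)

  nonroot : Fin n → ℕ
  nonroot x = 𝟙 (¬? (x ≟ root))

  ∑-up : ∀ x → ∑[ y < n ] 𝟙 (up? x y) ≡ nonroot x
  ∑-up x = by-cases (x ≟ root)
    where
    by-cases : Dec (x ≡ root) → ∑[ y < n ] 𝟙 (up? x y) ≡ nonroot x
    by-cases (yes x≡root) = trans (∑-𝟙-empty (up? x) λ _ u → proj₁ u x≡root)
                                  (sym (𝟙-no (¬? (x ≟ root)) (λ x≢root → x≢root x≡root)))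
    by-cases (no x≢root)  = trans (∑-𝟙-singleton (up? x) (parent x) λ y →
                                    mk⇔ (sym ∘ proj₂) (λ y≡parent → x≢root , sym y≡parent))
                                  (sym (𝟙-yes (¬? (x ≟ root)) x≢root))

  ∑-children : ∑[ x < n ] children x + 1 ≡ n
  ∑-children = begin
    ∑[ x < n ] ∑[ y < n ] 𝟙 (up? y x) + 1
      ≡⟨ cong₂ _+_ (∑-comm (λ x y → 𝟙 (up? y x))) (sym (∑-𝟙-≟ root)) ⟩
    ∑[ y < n ] parents y + ∑[ y < n ] 𝟙 (y ≟ root)
      ≡⟨ ∑-distrib-+ parents (λ y → 𝟙 (y ≟ root)) ⟨
    ∑[ y < n ] (parents y + 𝟙 (y ≟ root))
      ≡⟨ sum-cong-≗ (λ y → trans (cong (_+ 𝟙 (y ≟ root)) (∑-up y)) (𝟙-¬+𝟙 (y ≟ root))) ⟩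
    ∑[ y < n ] 1
      ≡⟨ ∑-1 n ⟩
    n ∎
    where
    open ≡-Reasoning
    parents : Fin n → ℕ
    parents y = ∑[ x < n ] 𝟙 (up? y x)

  children-∉ : ∀ x → x ∉ S → children x ≡ 0
  children-∉ x x∉S = ∑-𝟙-empty (λ y → up? y x) λ where
    y (y≢root , refl) → x∉S (parent∈S y y≢root)

  tree-graph : Graph n
  tree-graph = record
    { adj    = λ x y → does (tree-edge? x y)
    ; sym    = λ x y → does-⇔ (mk⇔ Sum.swap Sum.swap) (tree-edge? x y) (tree-edge? y x)
    ; irrefl = λ x → dec-false (tree-edge? x x) [ up-irreflexive , up-irreflexive ]′
    }

  edge⇒tree-edge : ∀ {x y} → Edge tree-graph x y → TreeEdge x y
  edge⇒tree-edge {x} {y} = from-does (tree-edge? x y)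

  tree-graph-spanning : SpanningSubgraph tree-graph H
  tree-graph-spanning _ _ = tree-edge-edge ∘ edge⇒tree-edge

  degree-tree-graph : ∀ x → degree tree-graph x ≡ children x + nonroot x
  degree-tree-graph x = begin
    degree tree-graph x                             ≡⟨ degree≡∑ tree-graph x ⟩
    ∑[ y < n ] 𝟙 (tree-edge? x y)                  ≡⟨ sum-cong-≗ (λ y → 𝟙-⊎ up-asymmetric (up? x y) (up? y x)) ⟩
    ∑[ y < n ] (𝟙 (up? x y) + 𝟙 (up? y x))         ≡⟨ ∑-distrib-+ (λ y → 𝟙 (up? x y)) (λ y → 𝟙 (up? y x)) ⟩
    ∑[ y < n ] 𝟙 (up? x y) + children x            ≡⟨ cong (_+ children x) (∑-up x) ⟩
    nonroot x + children x                         ≡⟨ +-comm (nonroot x) (children x) ⟩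
    children x + nonroot x                         ∎
    where open ≡-Reasoning

  walk-to-root : ∀ k x → rank x < k → Walk tree-graph (λ _ → ⊤) x root
  walk-to-root (suc k) x rank<1+k with x ≟ root
  ... | yes refl     = here tt
  ... | no  x≢root  = step tt (to-does (tree-edge? x (parent x)) (inj₁ (x≢root , refl)))
                        (walk-to-root k (parent x) (<-≤-trans (rank-parent x x≢root) (≤-pred rank<1+k)))

  tree-graph-connected : Connected tree-graph
  tree-graph-connected = (root , tt) , λ u v _ _ → to-root u ++ʷ walk-reverse (to-root v)
    where
    to-root : ∀ x → Walk tree-graph (λ _ → ⊤) x root
    to-root x = walk-to-root (suc (rank x)) x ≤-refl

  descent-continues : ∀ {x y z} → x ≢ z → Up y x → TreeEdge y z → Up z y
  descent-continues x≢z (_ , py≡x) (inj₁ (_ , py≡z)) = contradiction (trans (sym py≡x) py≡z) x≢z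
  descent-continues _   _          (inj₂ up)         = up

  ascent-continues : ∀ {x y z} → x ≢ z → TreeEdge x y → Up y z → Up x y
  ascent-continues _   (inj₁ up)          _          = up
  ascent-continues x≢z (inj₂ (_ , py≡x)) (_ , py≡z) = contradiction (trans (sym py≡x) py≡z) x≢z

  last-ascent : ∀ {y z} → parent z ≢ y → TreeEdge y z → Up y z
  last-ascent _    (inj₁ up)          = up
  last-ascent pz≢y (inj₂ (_ , pz≡y)) = contradiction pz≡y pz≢y

  keeps-descending : ∀ {x y} L → NonBacktracking (x ∷ y ∷ L) → Linked TreeEdge (x ∷ y ∷ L) →
                     Up y x → Linked (flip Up) (x ∷ y ∷ L)
  keeps-descending []      _          (_ ∷ [-])    down = down ∷ [-]
  keeps-descending (_ ∷ L) (x≢z , nb) (_ ∷ e ∷ es) down =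
    down ∷ keeps-descending L nb (e ∷ es) (descent-continues x≢z down e)

  keeps-ascending : ∀ {x y z} L → NonBacktracking (x ∷ y ∷ L ++ [ z ]) →
                    Linked TreeEdge (x ∷ y ∷ L ++ [ z ]) → All (parent z ≢_) (y ∷ L) →
                    Linked Up (x ∷ y ∷ L ++ [ z ])
  keeps-ascending []      (x≢z , _) (e ∷ e′ ∷ [-]) (pz≢y ∷ []) =
    ascent-continues x≢z e yz ∷ yz ∷ [-]
    where yz = last-ascent pz≢y e′
  keeps-ascending (_ ∷ L) (x≢w , nb) (e ∷ es) (_ ∷ pz∉L) with keeps-ascending L nb es pz∉L
  ... | up ∷ ups = ascent-continues x≢w e up ∷ up ∷ ups

  -- A non-backtracking tree walk never moves up after moving down.  A closed one starting
  -- down would be rank-increasing throughout; starting up, from v to a = parent v, its last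
  -- step cannot come down from a (a is not revisited), so it is rank-decreasing throughout.
  no-closed-tree-walk : ∀ {v a b} L → NonBacktracking (v ∷ a ∷ b ∷ L ++ [ v ]) →
                        All (a ≢_) (b ∷ L) → ¬ Linked TreeEdge (v ∷ a ∷ b ∷ L ++ [ v ])
  no-closed-tree-walk {v} {a} {b} L nb a∉ edges@(inj₂ down ∷ _) =
    <-irrefl refl (Linked-ends <-trans (a ∷ b ∷ L)
                  (Linked.map up-rank (keeps-descending (b ∷ L ++ [ v ]) nb edges down)))
  no-closed-tree-walk {v} {a} {b} L nb a∉ (inj₁ up@(_ , pv≡a) ∷ edges) =
    <-asym (up-rank up) (Linked-ends (flip <-trans) (b ∷ L)
                  (Linked.map up-rank (keeps-ascending L (proj₂ nb) edges
                    (subst (λ p → All (p ≢_) (b ∷ L)) (sym pv≡a) a∉))))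

  tree-graph-acyclic : ¬ HasCycle tree-graph
  tree-graph-acyclic (v , []        , _ , ()      , _)
  tree-graph-acyclic (v , _ ∷ []    , _ , s≤s () , _)
  tree-graph-acyclic (v , a ∷ b ∷ L , v∉@(_ ∷ v≢b ∷ _) ∷ !@(a∉ ∷ _) , _ , cycle) =
    no-closed-tree-walk L (v≢b , Unique⇒NonBacktracking (Unique-++-[] ! v∉)) a∉
                        (Linked.map edge⇒tree-edge cycle)

  -- Any other edge xy of H would close a cycle with the simple tree path from x to y.
  acyclic⇒tree-edge : ¬ HasCycle H → ∀ {x y} → Edge H x y → TreeEdge x y
  acyclic⇒tree-edge acyclic {x} {y} e with tree-edge? x y
  ... | yes xy = xy
  ... | no ¬xy = ⊥-elim (closes-cycle (loop-erase (proj₂ tree-graph-connected x y tt tt)))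
    where
    closes-cycle : SimpleWalk {G = tree-graph} x y → ⊥
    closes-cycle (here _ , _)               = subst T (Graph.irrefl H x) e
    closes-cycle (step _ xy (here _) , _)   = ¬xy (edge⇒tree-edge xy)
    closes-cycle (ω@(step _ _ ω′@(step _ _ ω″)) , !) = acyclic
      (x , vertices ω′ , ! , s≤s (1≤length-vertices ω″) ,
       vertices-++-linked (tree-edge-edge ∘ edge⇒tree-edge) ω (edge-sym H e))

  acyclic⇒degree-tree-graph : ¬ HasCycle H → ∀ x → degree tree-graph x ≡ degree H x
  acyclic⇒degree-tree-graph acyclic x =
    degree-cong {G = tree-graph} {H = H} x
      λ {y} → mk⇔ (tree-edge-edge ∘ edge⇒tree-edge) (to-does (tree-edge? x y) ∘ acyclic⇒tree-edge acyclic)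

-- Breadth-first search

LeastWitness : (ℕ → Set) → Set
LeastWitness P = ∃[ m ] (P m × (∀ {j} → j < m → ¬ P j))

module _ {P : ℕ → Set} (P? : Decidable P) where

  least-or-none-below : ∀ k → LeastWitness P ⊎ (∀ {j} → j < k → ¬ P j)
  least-or-none-below zero = inj₂ λ ()
  least-or-none-below (suc k) with least-or-none-below k | P? k
  ... | inj₁ found | _      = inj₁ found
  ... | inj₂ none  | yes Pk = inj₁ (k , Pk , none)
  ... | inj₂ none  | no ¬Pk = inj₂ λ j<1+k → [ none , (λ { refl → ¬Pk }) ]′ (m<1+n⇒m<n∨m≡n j<1+k)

  least-witness : ∀ {k} → P k → LeastWitness P
  least-witness {k} Pk = [ id , (λ none → k , Pk , none) ]′ (least-or-none-below k)

module BreadthFirst {n} (H : Graph n) (S : Subset n) (cds : IsCDS H S) where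

  root : Fin n
  root = proj₁ (proj₁ (proj₂ cds))

  root∈S : root ∈ S
  root∈S = proj₂ (proj₁ (proj₂ cds))

  -- x is reachable from the root in at most k steps through vertices of S (x itself may lie
  -- outside S); the least such k serves as rank, and the witnessing predecessor as parent.
  Reach : ℕ → Fin n → Set
  Reach zero    x = x ≡ root
  Reach (suc k) x = Reach k x ⊎ ∃[ u ] (Reach k u × u ∈ S × Edge H u x)

  reach? : ∀ k x → Dec (Reach k x)
  reach? zero    x = x ≟ root
  reach? (suc k) x = reach? k x ⊎-dec any? λ u → reach? k u ×-dec u ∈? S ×-dec T? (adj H u x)

  reach-along : ∀ {k a b} → Walk H (_∈ S) a b → Reach k a → ∃[ k′ ] Reach k′ b
  reach-along (here _)       r = _ , r
  reach-along (step a∈S e ω) r = reach-along ω (inj₂ (_ , r , a∈S , e))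

  reachable-∈ : ∀ {x} → x ∈ S → ∃[ k ] Reach k x
  reachable-∈ x∈S = reach-along (proj₂ (proj₂ cds) root _ root∈S x∈S) refl

  reachable : ∀ x → ∃[ k ] Reach k x
  reachable x with x ∈? S
  ... | yes x∈S = reachable-∈ x∈S
  ... | no  x∉S with proj₁ cds x x∉S
  ...   | u , u∈S , xu with reachable-∈ u∈S
  ...     | k , r = suc k , inj₂ (u , r , u∈S , edge-sym H xu)

  least-reach : ∀ x → LeastWitness (λ k → Reach k x)
  least-reach x = least-witness (λ k → reach? k x) (proj₂ (reachable x))

  rank : Fin n → ℕ
  rank x = proj₁ (least-reach x)

  rank-minimal : ∀ {k x} → Reach k x → rank x ≤ k
  rank-minimal {k} {x} r = ≮⇒≥ λ k<rank → proj₂ (proj₂ (least-reach x)) k<rank r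

  step-to-root : ∀ {x} m → Reach m x → (∀ {j} → j < m → ¬ Reach j x) → x ≢ root →
                 ∃[ u ] (u ∈ S × Edge H x u × rank u < m)
  step-to-root zero    x≡root                _       x≢root = contradiction x≡root x≢root
  step-to-root (suc j) (inj₁ r)              minimal _      = contradiction r (minimal ≤-refl)
  step-to-root (suc j) (inj₂ (u , r , u∈S , ux)) _   _      = u , u∈S , edge-sym H ux , s≤s (rank-minimal r)

  towards-root : ∀ x → x ≢ root → ∃[ u ] (u ∈ S × Edge H x u × rank u < rank x)
  towards-root x = let m , r , minimal = least-reach x in step-to-root m r minimal

  parent : Fin n → Fin n
  parent x with x ≟ root
  ... | yes _      = x
  ... | no  x≢root = proj₁ (towards-root x x≢root)

  parent-spec : ∀ x → x ≢ root → parent x ∈ S × Edge H x (parent x) × rank (parent x) < rank x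
  parent-spec x x≢root with x ≟ root
  ... | yes x≡root = contradiction x≡root x≢root
  ... | no  x≢root = proj₂ (towards-root x x≢root)

  rooted-tree : RootedTree H S
  rooted-tree = record
    { root        = root
    ; root∈S      = root∈S
    ; parent      = parent
    ; rank        = rank
    ; parent∈S    = λ v v≢root → proj₁ (parent-spec v v≢root)
    ; parent-edge = λ v v≢root → proj₁ (proj₂ (parent-spec v v≢root))
    ; rank-parent = λ v v≢root → proj₂ (proj₂ (parent-spec v v≢root))
    }

-- Counting children

capacity : ∀ {n} → ℕ → Subset n → Fin n → ℕ
capacity r S x = if does (x ∈? S) then r else 1

capacity≡1⊎r : ∀ {n} r (S : Subset n) x → capacity r S x ≡ 1 ⊎ capacity r S x ≡ r
capacity≡1⊎r r S x with does (x ∈? S)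
... | true  = inj₂ refl
... | false = inj₁ refl

module DegreeBudget {n} {H : Graph n} {S : Subset n} (𝒯 : RootedTree H S) (r : ℕ) (1≤r : 1 ≤ r) where
  open RootedTree 𝒯
  open RootedTreeProperties 𝒯

  budget : Fin n → ℕ
  budget x = 𝟙 (x ∈? S) * (r ∸ 1) + 𝟙 (x ≟ root)

  r∸1+1≡r : r ∸ 1 + 1 ≡ r
  r∸1+1≡r = m∸n+n≡m 1≤r

  capacity≡budget+nonroot : ∀ x → capacity r S x ≡ budget x + nonroot x
  capacity≡budget+nonroot x with x ∈? S | x ≟ root
  ... | yes _   | yes _    = sym (trans (+-identityʳ _) (trans (cong (_+ 1) (*-identityˡ (r ∸ 1))) r∸1+1≡r))
  ... | yes _   | no  _    = sym (trans (cong (_+ 1) (trans (+-identityʳ _) (*-identityˡ (r ∸ 1)))) r∸1+1≡r)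
  ... | no  x∉S | yes refl = contradiction root∈S x∉S
  ... | no  _   | no  _    = refl

  ∑-budget : ∑[ x < n ] budget x + 1 ≡ (r ∸ 1) * ∣ S ∣ + 2
  ∑-budget = begin
    ∑[ x < n ] budget x + 1
      ≡⟨ cong (_+ 1) (∑-distrib-+ (λ x → 𝟙 (x ∈? S) * (r ∸ 1)) (λ x → 𝟙 (x ≟ root))) ⟩
    ∑[ x < n ] (𝟙 (x ∈? S) * (r ∸ 1)) + ∑[ x < n ] 𝟙 (x ≟ root) + 1
      ≡⟨ cong₂ (λ a b → a + b + 1) ∑-scaled (∑-𝟙-≟ root) ⟩
    (r ∸ 1) * ∣ S ∣ + 1 + 1
      ≡⟨ +-assoc _ 1 1 ⟩
    (r ∸ 1) * ∣ S ∣ + 2 ∎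
    where
    open ≡-Reasoning
    ∑-scaled : ∑[ x < n ] (𝟙 (x ∈? S) * (r ∸ 1)) ≡ (r ∸ 1) * ∣ S ∣
    ∑-scaled = begin
      ∑[ x < n ] (𝟙 (x ∈? S) * (r ∸ 1))   ≡⟨ sum-cong-≗ (λ x → *-comm (𝟙 (x ∈? S)) (r ∸ 1)) ⟩
      ∑[ x < n ] ((r ∸ 1) * 𝟙 (x ∈? S))   ≡⟨ *-distribˡ-sum (r ∸ 1) (λ x → 𝟙 (x ∈? S)) ⟨
      (r ∸ 1) * ∑[ x < n ] 𝟙 (x ∈? S)     ≡⟨ cong ((r ∸ 1) *_) (∣S∣≡∑ S) ⟨
      (r ∸ 1) * ∣ S ∣                     ∎

  degree≤capacity⇒children≤budget : ∀ x → degree tree-graph x ≤ capacity r S x → children x ≤ budget x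
  degree≤capacity⇒children≤budget x ≤cap = +-cancelʳ-≤ (nonroot x) (children x) (budget x)
    (subst₂ _≤_ (degree-tree-graph x) (capacity≡budget+nonroot x) ≤cap)

  degree≡capacity⇒children≡budget : ∀ x → degree tree-graph x ≡ capacity r S x → children x ≡ budget x
  degree≡capacity⇒children≡budget x ≡cap = +-cancelʳ-≡ (nonroot x) (children x) (budget x)
    (trans (sym (degree-tree-graph x)) (trans ≡cap (capacity≡budget+nonroot x)))

  children≡budget⇒degree≡capacity : ∀ x → children x ≡ budget x → degree tree-graph x ≡ capacity r S x
  children≡budget⇒degree≡capacity x ≡budget = trans (degree-tree-graph x)
    (trans (cong (_+ nonroot x) ≡budget) (sym (capacity≡budget+nonroot x)))

  degree≤capacity : MaxDegreeAtMost H r → ∀ x → degree tree-graph x ≤ capacity r S x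
  degree≤capacity Δ≤r x with x ∈? S
  ... | yes _   = ≤-trans (degree-mono {G = tree-graph} {H = H} x (tree-graph-spanning x _)) (Δ≤r x)
  ... | no  x∉S = ≤-reflexive (begin
    degree tree-graph x      ≡⟨ degree-tree-graph x ⟩
    children x + nonroot x  ≡⟨ cong₂ _+_ (children-∉ x x∉S) (𝟙-yes (¬? (x ≟ root)) λ { refl → x∉S root∈S }) ⟩
    1                       ∎)
    where open ≡-Reasoning

  size-bound : (∀ x → children x ≤ budget x) → n ≤ (r ∸ 1) * ∣ S ∣ + 2
  size-bound ≤budget = begin
    n                          ≡⟨ ∑-children ⟨
    ∑[ x < n ] children x + 1  ≤⟨ +-monoˡ-≤ 1 (∑-mono-≤ ≤budget) ⟩
    ∑[ x < n ] budget x + 1    ≡⟨ ∑-budget ⟩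
    (r ∸ 1) * ∣ S ∣ + 2        ∎
    where open ≤-Reasoning

  size-tight : (∀ x → children x ≤ budget x) → (r ∸ 1) * ∣ S ∣ + 2 ≡ n → ∀ x → children x ≡ budget x
  size-tight ≤budget tight = ∑-mono-≡⇒≗ ≤budget
    (+-cancelʳ-≡ 1 _ _ (trans ∑-children (trans (sym tight) (sym ∑-budget))))

  size-exact : (∀ x → children x ≡ budget x) → (r ∸ 1) * ∣ S ∣ + 2 ≡ n
  size-exact ≡budget = trans (sym ∑-budget) (trans (cong (_+ 1) (sum-cong-≗ (sym ∘ ≡budget))) ∑-children)

-- (1,r)-trees

some-other : ∀ {n} → 2 ≤ n → (v : Fin n) → ∃[ w ] v ≢ w
some-other (s≤s (s≤s _)) zero    = suc zero , λ ()
some-other (s≤s (s≤s _)) (suc v) = zero , λ ()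

not-covered-by-two : ∀ {n} {v u : Fin n} → 3 ≤ n → ¬ (∀ z → z ≡ v ⊎ z ≡ u)
not-covered-by-two (s≤s (s≤s (s≤s _))) covers
  with covers zero | covers (suc zero) | covers (suc (suc zero))
... | inj₁ refl | inj₁ ()   | _
... | inj₁ refl | inj₂ refl | inj₁ ()
... | inj₁ refl | inj₂ refl | inj₂ ()
... | inj₂ refl | inj₁ refl | inj₁ ()
... | inj₂ refl | inj₁ refl | inj₂ ()
... | inj₂ refl | inj₂ ()   | _

module OneRTree {n} (K : Graph n) (r : ℕ) (connected : Connected K)
                (degree≡1⊎r : ∀ v → degree K v ≡ 1 ⊎ degree K v ≡ r) where

  internal : Subset n
  internal = subset (λ x → degree K x ℕ.≟ r)

  internal-degree : ∀ {x} → x ∈ internal → degree K x ≡ r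
  internal-degree = ∈-subset⁻ (λ x → degree K x ℕ.≟ r)

  leaf-degree : ∀ {x} → x ∉ internal → degree K x ≡ 1
  leaf-degree {x} x∉ with degree≡1⊎r x
  ... | inj₁ ≡1 = ≡1
  ... | inj₂ ≡r = contradiction (∈-subset⁺ (λ x → degree K x ℕ.≟ r) ≡r) x∉

  degree≡capacity : ∀ x → degree K x ≡ capacity r internal x
  degree≡capacity x with x ∈? internal
  ... | yes x∈ = internal-degree x∈
  ... | no  x∉ = leaf-degree x∉

  leaf-unique : ∀ {x a b} → x ∉ internal → Edge K x a → Edge K x b → a ≡ b
  leaf-unique x∉ = leaf-neighbour-unique K (leaf-degree x∉)

  internal-dominating : 3 ≤ n → ∀ v → v ∉ internal → ∃[ u ] (u ∈ internal × Edge K v u)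
  internal-dominating 3≤n v v∉ with neighbour connected (proj₂ (some-other (<⇒≤ 3≤n) v))
  ... | u , vu with u ∈? internal
  ...   | yes u∈ = u , u∈ , vu
  ...   | no  u∉ = ⊥-elim (not-covered-by-two 3≤n λ z → trapped (proj₂ connected v z tt tt) (inj₁ refl))
    where
    trapped : ∀ {a z} → Walk K (λ _ → ⊤) a z → a ≡ v ⊎ a ≡ u → z ≡ v ⊎ z ≡ u
    trapped (here _)        a∈ = a∈
    trapped (step _ e ω) (inj₁ refl) = trapped ω (inj₂ (leaf-unique v∉ e vu))
    trapped (step _ e ω) (inj₂ refl) = trapped ω (inj₁ (leaf-unique u∉ e (edge-sym K vu)))

  internal-walk : ∀ {a b} → Walk K (λ _ → ⊤) a b → a ∈ internal → b ∈ internal → Walk K (_∈ internal) a b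
  internal-walk (here _) a∈ _ = here a∈
  internal-walk (step {w = c} _ ac ω) a∈ b∈ with c ∈? internal | ω
  ... | yes c∈ | _               = step a∈ ac (internal-walk ω c∈ b∈)
  ... | no  c∉ | here _          = contradiction b∈ c∉
  ... | no  c∉ | step _ cd ω′ with leaf-unique c∉ cd (edge-sym K ac)
  ...   | refl = internal-walk ω′ a∈ b∈

  internal-cds : 3 ≤ n → IsCDS K internal
  internal-cds 3≤n = internal-dominating 3≤n , nonempty , λ u v u∈ v∈ → internal-walk (proj₂ connected u v tt tt) u∈ v∈
    where
    nonempty : ∃[ v ] (v ∈ internal)
    nonempty with proj₁ (proj₁ connected) ∈? internal
    ... | yes v∈ = _ , v∈
    ... | no  v∉ = let u , u∈ , _ = internal-dominating 3≤n _ v∉ in u , u∈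

module _ {n} {G : Graph n} {S : Subset n} {r : ℕ} (1≤r : 1 ≤ r) (Δ≤r : MaxDegreeAtMost G r) (cds : IsCDS G S) where
  private
    𝒯 = BreadthFirst.rooted-tree G S cds
  open RootedTreeProperties 𝒯
  open DegreeBudget 𝒯 r 1≤r

  private
    children≤budget : ∀ x → children x ≤ budget x
    children≤budget x = degree≤capacity⇒children≤budget x (degree≤capacity Δ≤r x)

  cds-size-bound : n ≤ (r ∸ 1) * ∣ S ∣ + 2
  cds-size-bound = size-bound children≤budget

  tight-cds⇒spanning-1r-tree : (r ∸ 1) * ∣ S ∣ + 2 ≡ n → HasSpanning1rTree r G
  tight-cds⇒spanning-1r-tree tight =
    tree-graph , tree-graph-spanning , (tree-graph-connected , tree-graph-acyclic) , λ x →
      subst (λ d → d ≡ 1 ⊎ d ≡ r) (sym (children≡budget⇒degree≡capacity x (size-tight children≤budget tight x)))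
            (capacity≡1⊎r r S x)

spanning-1r-tree⇒tight-cds : ∀ {n} {G : Graph n} {r} → 1 ≤ r → 3 ≤ n → HasSpanning1rTree r G →
                             Σ[ I ∈ Subset n ] (IsCDS G I × (r ∸ 1) * ∣ I ∣ + 2 ≡ n)
spanning-1r-tree⇒tight-cds {n} {G} {r} 1≤r 3≤n (K , K⊆G , (K-connected , K-acyclic) , degree≡1⊎r) =
  internal , cds-spanning K⊆G I-cds , size-exact λ x →
    degree≡capacity⇒children≡budget x (trans (acyclic⇒degree-tree-graph K-acyclic x) (degree≡capacity x))
  where
  open OneRTree K r K-connected degree≡1⊎r
  I-cds = internal-cds 3≤n
  𝒯 = BreadthFirst.rooted-tree K internal I-cds
  open RootedTreeProperties 𝒯
  open DegreeBudget 𝒯 r 1≤r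

theorem6 : (r : ℕ) → 3 ≤ r → (n : ℕ) → (G : Graph n) → Connected G →
    MaxDegreeAtMost G r → (S : Subset n) → IsMinimumCDS G S →
    (n ≤ (r ∸ 1) * ∣ S ∣ + 2)
    × (3 ≤ n → (((r ∸ 1) * ∣ S ∣ + 2 ≡ n) ⇔ HasSpanning1rTree r G))
theorem6 r 3≤r n G _ Δ≤r S (cds , minimum) =
  cds-size-bound 1≤r Δ≤r cds ,
  λ 3≤n → mk⇔ (tight-cds⇒spanning-1r-tree 1≤r Δ≤r cds) λ spanning-tree →
    let I , I-cds , I-tight = spanning-1r-tree⇒tight-cds 1≤r 3≤n spanning-tree in
    ≤-antisym (begin
      (r ∸ 1) * ∣ S ∣ + 2  ≤⟨ +-monoˡ-≤ 2 (*-monoʳ-≤ (r ∸ 1) (minimum I I-cds)) ⟩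
      (r ∸ 1) * ∣ I ∣ + 2  ≡⟨ I-tight ⟩
      n                    ∎)
      (cds-size-bound 1≤r Δ≤r cds)
  where
  1≤r : 1 ≤ r
  1≤r = ≤-trans (s≤s z≤n) 3≤r
  open ≤-Reasoning
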